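{- For every global transition $\tau$ of the population model and every state $\mathbf{X}=(X_{s,q})_{s\in S,q\in Q}$ of the product population model, the rates of the instances of $\tau$ sum to the original rate: $\sum_{\vec{q}\in Q^k} f_{\vec{q}}^{(N)} (\mathbf{X}) = f^{(N)} (\widetilde{\mathbf{X}})$, i.e. \[ \sum_{\vec{q}\in Q^k} \frac{\prod_{(s,q)\in LHS(\mathrm{Sync}_{\tau,\vec{q}})} \frac{X_{s,q}!}{(X_{s,q}-\kappa_{s}^{q} )!}}{\prod_{s\in LHS(\mathrm{Sync}_{\tau})} \frac{X_{s}!}{(X_{s}-\kappa_{s} )!}} = 1.\]
   Context: A population model of size $N$ consists of $N$ agents of a class with finite local state space $S$; a global transition $\tau=(\mathrm{Sync}_\tau, f^{(N)})$ has a synchronization set $\mathrm{Sync}_{\tau} = \{ s_1\xrightarrow{\alpha_{s_1}} s_1',\ldots, s_k\xrightarrow{\alpha_{s_k}} s_k'\}$ of local transitions (labels made unique) and a rate function $f^{(N)}$, assumed zero when there are not enough agents to perform the transition. A local path property is a one-global-clock deterministic timed automaton with finite state set $Q$; on a time interval where clock constraints are fixed it induces a deterministic edge relation, and the product population model has counting variables $X_{s,q}$ = number of agents in local state $s$ whose property automaton is in state $q$, with aggregated counts $X_s=\sum_{q\in Q}X_{s,q}$ and $\widetilde{\mathbf{X}}=(X_s)_{s\in S}$. For each choice $\vec{q}=(q_1,\ldots,q_k)\in Q^k$, the instance of $\tau$ has synchronization set $\mathrm{Sync}_{\tau,\vec{q}} = \{ (s_1,q_1)\xrightarrow{\alpha_{s_1}}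 (s_1',q_1'),\ldots, (s_k,q_k)\xrightarrow{\alpha_{s_k}} (s_k',q_k')\}$, where $q_i'$ is the unique automaton state with $q_i\xrightarrow{\alpha_{s_i}} q_i'$, and rate \[ f_{\vec{q}}^{(N)} (\mathbf{X}) = \frac{\prod_{(s,q)\in LHS(\mathrm{Sync}_{\tau,\vec{q}})} \frac{X_{s,q}!}{(X_{s,q}-\kappa_{s}^{q} )!}}{\prod_{s\in LHS(\mathrm{Sync}_{\tau})} \frac{X_{s}!}{(X_{s}-\kappa_{s} )!} } f^{(N)} (\widetilde{\mathbf{X}}), \] where $LHS(\cdot)$ is the set of states appearing on the left-hand side of a rule in the given synchronization set, $\kappa_{s}^{q}$ is the multiplicity of $(s,q)$ as a left-hand side in $\mathrm{Sync}_{\tau,\vec{q}}$, and $\kappa_s$ is the multiplicity of $s$ as a left-hand side in $\mathrm{Sync}_\tau$ (each factor $X!/(X-\kappa)!$ is the falling factorial $X(X-1)\cdots(X-\kappa+1)$, taken as zero if $X<\kappa$; the identity is meant when $X_s\ge\kappa_s$ for all relevant $s$, so the denominator is nonzero). -}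

module Defs where

open import Data.Nat using (ℕ; zero; suc; _+_; _*_)
open import Data.Nat.Combinatorics using (_P_)
open import Data.Fin using (Fin; zero; suc)
open import Data.Fin.Properties using (_≟_)
open import Relation.Nullary.Decidable using (⌊_⌋)
open import Data.Bool using (if_then_else_)

Σ[Fin] : (n : ℕ) → (Fin n → ℕ) → ℕ
Σ[Fin] zero    f = 0
Σ[Fin] (suc n) f = f zero + Σ[Fin] n (λ i → f (suc i))

Π[Fin] : (n : ℕ) → (Fin n → ℕ) → ℕ
Π[Fin] zero    f = 1
Π[Fin] (suc n) f = f zero * Π[Fin] n (λ i → f (suc i))

Σ[Vec] : (nQ k : ℕ) → ((Fin k → Fin nQ) → ℕ) → ℕ
Σ[Vec] nQ zero    F = F (λ ())
Σ[Vec] nQ (suc k) F =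
  Σ[Fin] nQ (λ q → Σ[Vec] nQ k (λ v → F (λ { zero → q ; (suc i) → v i })))

-- Falling factorial  X!/(X-κ)!  (zero when X < κ): the stdlib's  X P κ.
falling : ℕ → ℕ → ℕ
falling X κ = X P κ

count : (k : ℕ) → (Fin k → Data.Bool.Bool) → ℕ
count k p = Σ[Fin] k (λ i → if p i then 1 else 0)
  where open import Data.Bool using (Bool)

record LocalTransition (nS : ℕ) (Act : Set) : Set where
  constructor _─[_]→_
  field
    src : Fin nS
    act : Act
    tgt : Fin nS
open LocalTransition public

-- Synchronisation set of a global transition: k local transitions (labels made unique).
Sync : (nS : ℕ) (Act : Set) (k : ℕ) → Set
Sync nS Act k = Fin k → LocalTransition nS Act

κ : ∀ {nS Act k} → Sync nS Act k → Fin nS → ℕ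
κ {k = k} sync s = count k (λ i → ⌊ src (sync i) ≟ s ⌋)

-- κ_s^q : multiplicity of (s,q) as a left-hand side in Sync_{τ,q⃗}
-- (the i-th rule of Sync_{τ,q⃗} has left-hand side (src (sync i), q⃗ i)).
κq : ∀ {nS nQ Act k} → Sync nS Act k → (Fin k → Fin nQ) → Fin nS → Fin nQ → ℕ
κq {k = k} sync qv s q =
  count k (λ i → if ⌊ src (sync i) ≟ s ⌋ then ⌊ qv i ≟ q ⌋ else Data.Bool.false)

aggregate : ∀ {nS nQ} → (Fin nS → Fin nQ → ℕ) → Fin nS → ℕ
aggregate {nQ = nQ} X s = Σ[Fin] nQ (X s)

-- Pairs (s,q) not in LHS(Sync_{τ,q⃗}) have κ_s^q = 0 and contribute the factor 1,
-- so taking the product over all of S × Q equals the product over the LHS.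
numerator : ∀ {nS nQ Act k} → Sync nS Act k → (Fin nS → Fin nQ → ℕ) → (Fin k → Fin nQ) → ℕ
numerator {nS} {nQ} sync X qv =
  Π[Fin] nS (λ s → Π[Fin] nQ (λ q → falling (X s q) (κq sync qv s q)))

-- Denominator:  Π_{s} X_s!/(X_s-κ_s)!  (again factors with κ_s = 0 are 1).
denominator : ∀ {nS nQ Act k} → Sync nS Act k → (Fin nS → Fin nQ → ℕ) → ℕ
denominator {nS} sync X =
  Π[Fin] nS (λ s → falling (aggregate X s) (κ sync s))

{-# OPTIONS --safe #-}
-- Once the automaton state q
-- of the agent performing the first rule (from s₀) is fixed, that agent
-- contributes the factor X s₀ q to the numerator, and what is left is the
-- numerator for the other k - 1 rules on the configuration with this agent
-- removed. By induction its sum over the remaining states is the denominator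
-- of the smaller configuration, which depends only on the aggregated counts
-- and hence not on q; summing X s₀ q over q then yields the factor X_{s₀}
-- that the first rule contributes to the denominator.
module Submission where

open import Defs
import Algebra.Properties.CommutativeSemigroup as CommutativeSemigroupProperties
open import Data.Nat using (ℕ; zero; suc; _+_; _*_; _∸_; _≤_; _<_; _≤ᵇ_; s≤s; z≤n)
open import Data.Nat.Properties
  using (*-identityˡ; *-identityʳ; *-zeroʳ; *-commutativeSemigroup; *-distribˡ-+; *-distribʳ-+;
         +-suc; m≤n⇒m∸n≡0; ≤⇒≤ᵇ; ≰⇒>)
open import Data.Nat.Combinatorics using (_P_)
open import Data.Nat.Combinatorics.Base using (_P′_)
open import Data.Nat.Combinatorics.Specification using (nP′k≡n[n∸1P′k∸1])
open import Data.Fin using (Fin; zero; suc)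
open import Data.Fin.Properties using (_≟_)
open import Data.Vec.Functional using (head; tail)
open import Data.Bool using (Bool; true; false; if_then_else_; T)
open import Relation.Nullary.Decidable using (⌊_⌋; ⌊⌋-map′; yes; no)
open import Relation.Binary.PropositionalEquality
open ≡-Reasoning

nP′k≡0 : ∀ {n k} → n < k → n P′ k ≡ 0
nP′k≡0 {n} {suc k} (s≤s n≤k) = cong (_* (n P′ k)) (m≤n⇒m∸n≡0 n≤k)

nPk≡nP′k : ∀ n k → n P k ≡ n P′ k
nPk≡nP′k n k with k ≤ᵇ n in eq
... | true  = refl
... | false = sym (nP′k≡0 {n} {k} (≰⇒> λ k≤n → subst T eq (≤⇒≤ᵇ k≤n)))

nP[1+k]≡n*[n∸1]Pk : ∀ n k → n P suc k ≡ n * ((n ∸ 1) P k)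
nP[1+k]≡n*[n∸1]Pk zero    k = refl
nP[1+k]≡n*[n∸1]Pk (suc n) k = begin
  suc n P suc k     ≡⟨ nPk≡nP′k (suc n) (suc k) ⟩
  suc n P′ suc k    ≡⟨ nP′k≡n[n∸1P′k∸1] (suc n) (suc k) ⟩
  suc n * (n P′ k)  ≡⟨ cong (suc n *_) (nPk≡nP′k n k) ⟨
  suc n * (n P k)   ∎

indicator : Bool → ℕ
indicator b = if b then 1 else 0

falling-peel : ∀ b X a →
  falling X (indicator b + a) ≡ (if b then X else 1) * falling (X ∸ indicator b) a
falling-peel true  X a = nP[1+k]≡n*[n∸1]Pk X a
falling-peel false X a = sym (*-identityˡ _)

Σ-cong : ∀ n {f g : Fin n → ℕ} → (∀ i → f i ≡ g i) → Σ[Fin] n f ≡ Σ[Fin] n g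
Σ-cong zero    f≗g = refl
Σ-cong (suc n) f≗g = cong₂ _+_ (f≗g zero) (Σ-cong n (λ i → f≗g (suc i)))

Π-cong : ∀ n {f g : Fin n → ℕ} → (∀ i → f i ≡ g i) → Π[Fin] n f ≡ Π[Fin] n g
Π-cong zero    f≗g = refl
Π-cong (suc n) f≗g = cong₂ _*_ (f≗g zero) (Π-cong n (λ i → f≗g (suc i)))

Σ[Vec]-cong : ∀ nQ k {F G : (Fin k → Fin nQ) → ℕ} →
  (∀ v → F v ≡ G v) → Σ[Vec] nQ k F ≡ Σ[Vec] nQ k G
Σ[Vec]-cong nQ zero    F≗G = F≗G _
Σ[Vec]-cong nQ (suc k) F≗G = Σ-cong nQ (λ q → Σ[Vec]-cong nQ k (λ v → F≗G _))

Σ[Vec]-head-tail : ∀ nQ k (F : (Fin (suc k) → Fin nQ) → ℕ) (G : Fin nQ → (Fin k → Fin nQ) → ℕ) →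
  (∀ qv → F qv ≡ G (head qv) (tail qv)) →
  Σ[Vec] nQ (suc k) F ≡ Σ[Fin] nQ (λ q → Σ[Vec] nQ k (G q))
Σ[Vec]-head-tail nQ k F G F≗G = Σ-cong nQ (λ q → Σ[Vec]-cong nQ k (λ v → F≗G _))

*-distribˡ-Σ : ∀ n c (f : Fin n → ℕ) → c * Σ[Fin] n f ≡ Σ[Fin] n (λ i → c * f i)
*-distribˡ-Σ zero    c f = *-zeroʳ c
*-distribˡ-Σ (suc n) c f =
  trans (*-distribˡ-+ c (f zero) _) (cong (c * f zero +_) (*-distribˡ-Σ n c (λ i → f (suc i))))

*-distribʳ-Σ : ∀ n c (f : Fin n → ℕ) → Σ[Fin] n f * c ≡ Σ[Fin] n (λ i → f i * c)
*-distribʳ-Σ zero    c f = refl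
*-distribʳ-Σ (suc n) c f =
  trans (*-distribʳ-+ c (f zero) _) (cong (f zero * c +_) (*-distribʳ-Σ n c (λ i → f (suc i))))

*-distribˡ-Σ[Vec] : ∀ nQ k c (F : (Fin k → Fin nQ) → ℕ) →
  c * Σ[Vec] nQ k F ≡ Σ[Vec] nQ k (λ v → c * F v)
*-distribˡ-Σ[Vec] nQ zero    c F = refl
*-distribˡ-Σ[Vec] nQ (suc k) c F =
  trans (*-distribˡ-Σ nQ c _) (Σ-cong nQ (λ q → *-distribˡ-Σ[Vec] nQ k c _))

Π-1 : ∀ n → Π[Fin] n (λ _ → 1) ≡ 1
Π-1 zero    = refl
Π-1 (suc n) = cong (1 *_) (Π-1 n)

Π-distrib-* : ∀ n (f g : Fin n → ℕ) →
  Π[Fin] n (λ i → f i * g i) ≡ Π[Fin] n f * Π[Fin] n g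
Π-distrib-* zero    f g = refl
Π-distrib-* (suc n) f g =
  trans (cong (f zero * g zero *_) (Π-distrib-* n (λ i → f (suc i)) (λ i → g (suc i))))
        (interchange (f zero) (g zero) _ _)
  where open CommutativeSemigroupProperties *-commutativeSemigroup using (interchange)

Π-single : ∀ n (j : Fin n) (g : Fin n → ℕ) →
  Π[Fin] n (λ i → if ⌊ j ≟ i ⌋ then g i else 1) ≡ g j
Π-single (suc n) zero    g = trans (cong (g zero *_) (Π-1 n)) (*-identityʳ (g zero))
Π-single (suc n) (suc j) g = trans (*-identityˡ _) (begin
  Π[Fin] n (λ i → if ⌊ suc j ≟ suc i ⌋ then g (suc i) else 1)
    ≡⟨ Π-cong n (λ i → cong (if_then g (suc i) else 1) (⌊⌋-map′ _ _ (j ≟ i))) ⟩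
  Π[Fin] n (λ i → if ⌊ j ≟ i ⌋ then g (suc i) else 1)
    ≡⟨ Π-single n j (λ i → g (suc i)) ⟩
  g (suc j) ∎)

Σ≡1+Σ-remove : ∀ n (j : Fin n) (f : Fin n → ℕ) → 0 < f j →
  Σ[Fin] n f ≡ 1 + Σ[Fin] n (λ i → f i ∸ indicator ⌊ j ≟ i ⌋)
Σ≡1+Σ-remove (suc n) zero    f 0<fj with f zero
... | suc m = refl
Σ≡1+Σ-remove (suc n) (suc j) f 0<fj = begin
  f zero + Σ[Fin] n (λ i → f (suc i))
    ≡⟨ cong (f zero +_) (Σ≡1+Σ-remove n j (λ i → f (suc i)) 0<fj) ⟩
  f zero + (1 + Σ[Fin] n (λ i → f (suc i) ∸ indicator ⌊ j ≟ i ⌋))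
    ≡⟨ +-suc (f zero) _ ⟩
  1 + (f zero + Σ[Fin] n (λ i → f (suc i) ∸ indicator ⌊ j ≟ i ⌋))
    ≡⟨ cong (λ t → 1 + (f zero + t))
         (Σ-cong n (λ i → cong (λ b → f (suc i) ∸ indicator b) (⌊⌋-map′ _ _ (j ≟ i)))) ⟨
  1 + (f zero + Σ[Fin] n (λ i → f (suc i) ∸ indicator ⌊ suc j ≟ suc i ⌋)) ∎

*-congˡ-positive : ∀ x {a b} → (0 < x → a ≡ b) → x * a ≡ x * b
*-congˡ-positive zero    a≡b = refl
*-congˡ-positive (suc x) a≡b = cong (suc x *_) (a≡b (s≤s z≤n))

fallingProduct : ∀ n → (Fin n → ℕ) → (Fin n → ℕ) → ℕ
fallingProduct n Y a = Π[Fin] n (λ i → falling (Y i) (a i))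

fallingProduct-peel : ∀ n (b : Fin n → Bool) (Y a : Fin n → ℕ) →
  fallingProduct n Y (λ i → indicator (b i) + a i)
    ≡ Π[Fin] n (λ i → if b i then Y i else 1) * fallingProduct n (λ i → Y i ∸ indicator (b i)) a
fallingProduct-peel n b Y a =
  trans (Π-cong n (λ i → falling-peel (b i) (Y i) (a i))) (Π-distrib-* n _ _)

module _ {nS nQ : ℕ} where

  -- Written exactly as Defs.κq tests a rule, so that κq sync qv s q unfolds to
  -- indicator (isAt (src (head sync)) (head qv) s q) + κq (tail sync) (tail qv) s q.
  isAt : Fin nS → Fin nQ → Fin nS → Fin nQ → Bool
  isAt s₀ q₀ s q = if ⌊ s₀ ≟ s ⌋ then ⌊ q₀ ≟ q ⌋ else false

  removeAgent : Fin nS → Fin nQ → (Fin nS → Fin nQ → ℕ) → Fin nS → Fin nQ → ℕ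
  removeAgent s₀ q₀ X s q = X s q ∸ indicator (isAt s₀ q₀ s q)

  Π-Π-isAt : ∀ s₀ q₀ (X : Fin nS → Fin nQ → ℕ) →
    Π[Fin] nS (λ s → Π[Fin] nQ (λ q → if isAt s₀ q₀ s q then X s q else 1)) ≡ X s₀ q₀
  Π-Π-isAt s₀ q₀ X = trans (Π-cong nS atRow) (Π-single nS s₀ (λ s → X s q₀))
    where
    atRow : ∀ s → Π[Fin] nQ (λ q → if isAt s₀ q₀ s q then X s q else 1)
                  ≡ (if ⌊ s₀ ≟ s ⌋ then X s q₀ else 1)
    atRow s with ⌊ s₀ ≟ s ⌋
    ... | true  = Π-single nQ q₀ (X s)
    ... | false = Π-1 nQ

  aggregate-removeAgent : ∀ s₀ q₀ (X : Fin nS → Fin nQ → ℕ) → 0 < X s₀ q₀ → ∀ s →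
    aggregate (removeAgent s₀ q₀ X) s ≡ aggregate X s ∸ indicator ⌊ s₀ ≟ s ⌋
  aggregate-removeAgent s₀ q₀ X 0<X s with s₀ ≟ s
  ... | yes refl = sym (cong (_∸ 1) (Σ≡1+Σ-remove nQ q₀ (X s₀) 0<X))
  ... | no  _    = refl

module _ {nS nQ : ℕ} {Act : Set} {k : ℕ} (sync : Sync nS Act (suc k))
         (X : Fin nS → Fin nQ → ℕ) where

  private
    s₀ : Fin nS
    s₀ = src (head sync)

  reducedDenominator : ℕ
  reducedDenominator = fallingProduct nS (λ s → aggregate X s ∸ indicator ⌊ s₀ ≟ s ⌋) (κ (tail sync))

  numerator-peel : ∀ qv →
    numerator sync X qv ≡ X s₀ (head qv) * numerator (tail sync) (removeAgent s₀ (head qv) X) (tail qv)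
  numerator-peel qv = begin
    numerator sync X qv
      ≡⟨ Π-cong nS (λ s → fallingProduct-peel nQ (isAt s₀ q₀ s) (X s) (κq (tail sync) (tail qv) s)) ⟩
    Π[Fin] nS (λ s → Π[Fin] nQ (λ q → if isAt s₀ q₀ s q then X s q else 1)
                     * fallingProduct nQ (removeAgent s₀ q₀ X s) (κq (tail sync) (tail qv) s))
      ≡⟨ Π-distrib-* nS _ _ ⟩
    Π[Fin] nS (λ s → Π[Fin] nQ (λ q → if isAt s₀ q₀ s q then X s q else 1))
      * numerator (tail sync) (removeAgent s₀ q₀ X) (tail qv)
      ≡⟨ cong (_* numerator (tail sync) (removeAgent s₀ q₀ X) (tail qv)) (Π-Π-isAt s₀ q₀ X) ⟩
    X s₀ q₀ * numerator (tail sync) (removeAgent s₀ q₀ X) (tail qv) ∎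
    where q₀ = head qv

  denominator-peel : denominator sync X ≡ aggregate X s₀ * reducedDenominator
  denominator-peel =
    trans (fallingProduct-peel nS (λ s → ⌊ s₀ ≟ s ⌋) (aggregate X) (κ (tail sync)))
          (cong (_* reducedDenominator) (Π-single nS s₀ (aggregate X)))

  denominator-removeAgent : ∀ q₀ → 0 < X s₀ q₀ → denominator (tail sync) (removeAgent s₀ q₀ X)
    ≡ reducedDenominator
  denominator-removeAgent q₀ 0<X =
    Π-cong nS (λ s → cong (λ Y → falling Y (κ (tail sync) s)) (aggregate-removeAgent s₀ q₀ X 0<X s))

Σ-numerator≡denominator : ∀ {nS nQ Act} k (sync : Sync nS Act k) (X : Fin nS → Fin nQ → ℕ) →
  Σ[Vec] nQ k (numerator sync X) ≡ denominator sync X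
Σ-numerator≡denominator {nS} {nQ} zero sync X =
  trans (Π-cong nS (λ _ → Π-1 nQ)) (trans (Π-1 nS) (sym (Π-1 nS)))
Σ-numerator≡denominator {nS} {nQ} (suc k) sync X = begin
  Σ[Vec] nQ (suc k) (numerator sync X)
    ≡⟨ Σ[Vec]-head-tail nQ k _ _ (numerator-peel sync X) ⟩
  Σ[Fin] nQ (λ q → Σ[Vec] nQ k (λ v → X s₀ q * numerator (tail sync) (removeAgent s₀ q X) v))
    ≡⟨ Σ-cong nQ (λ q → *-distribˡ-Σ[Vec] nQ k (X s₀ q) _) ⟨
  Σ[Fin] nQ (λ q → X s₀ q * Σ[Vec] nQ k (numerator (tail sync) (removeAgent s₀ q X)))
    ≡⟨ Σ-cong nQ (λ q → cong (X s₀ q *_) (Σ-numerator≡denominator k (tail sync) _)) ⟩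
  Σ[Fin] nQ (λ q → X s₀ q * denominator (tail sync) (removeAgent s₀ q X))
    -- Truncated subtraction: removing an agent from an empty class (s₀, q) does not
    -- lower the aggregate, but such terms carry the weight X s₀ q = 0.
    ≡⟨ Σ-cong nQ (λ q → *-congˡ-positive (X s₀ q) (denominator-removeAgent sync X q)) ⟩
  Σ[Fin] nQ (λ q → X s₀ q * reducedDenominator sync X)
    ≡⟨ *-distribʳ-Σ nQ (reducedDenominator sync X) (X s₀) ⟨
  aggregate X s₀ * reducedDenominator sync X
    ≡⟨ denominator-peel sync X ⟨
  denominator sync X ∎
  where s₀ = src (head sync)

proposition2 : (nS nQ : ℕ) (Act : Set) (k : ℕ) (sync : Sync nS Act k)
    (δ : Fin nQ → Act → Fin nQ)
    (X : Fin nS → Fin nQ → ℕ) →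
    (∀ s → κ sync s ≤ aggregate X s) →
    Σ[Vec] nQ k (numerator sync X) ≡ denominator sync X
-- δ only determines right-hand sides, which no rate mentions, and with the
-- denominator cleared the identity holds even when X_s < κ_s.
proposition2 nS nQ Act k sync δ X _ = Σ-numerator≡denominator k sync X
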